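{- Let $\gamma$ be a constant with $2\log_2 3-3\le\gamma\le 1$ and let $\beta=(1-\gamma)/2$. For every $n\ge k\ge 0$ and every graph $G$ on $n$ vertices, the number of minimal vertex covers of $G$ of size at most $k$ is at most $2^{\beta n+\gamma k}$.
   Context: Graphs are finite, simple and undirected. A vertex cover of $G=(V,E)$ is a set $C\subseteq V$ containing at least one endpoint of every edge; it is minimal if no proper subset of it is a vertex cover.
   Formalization: The constant γ takes only rational values in the admissible range. -}

module Defs where

open import Data.Nat using (ℕ)
open import Data.Fin using (Fin)
open import Data.Fin.Subset using (Subset; _∈_; _⊂_)
open import Data.Sum using (_⊎_)
open import Relation.Nullary using (¬_)
open import Relation.Binary.PropositionalEquality using (_≡_)
open import Data.Product using (_×_)

record Graph (n : ℕ) : Set₁ where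
  field
    Adj    : Fin n → Fin n → Set
    sym    : ∀ {i j} → Adj i j → Adj j i
    irrefl : ∀ {i} → ¬ Adj i i
open Graph public

IsVertexCover : ∀ {n} → Graph n → Subset n → Set
IsVertexCover G C = ∀ i j → Adj G i j → (i ∈ C) ⊎ (j ∈ C)

IsMinimalVertexCover : ∀ {n} → Graph n → Subset n → Set
IsMinimalVertexCover G C = IsVertexCover G C × (∀ D → D ⊂ C → ¬ IsVertexCover G D)

{-# OPTIONS --safe #-}
-- Count the minimal covers C with ∣ C ∣ ≤ k of induced subgraphs G[S], by recursion on S.  Let v
-- minimise m = ∣ S ∩ N[ v ] ∣ (one more than its degree in G[S]).  Every minimal cover C misses some
-- u ∈ S ∩ N[ v ]: v itself, or else a neighbour of v outside C, which exists by minimality.  Such a C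
-- contains all S-neighbours of u, so it is determined by C ─ N[ u ], a minimal cover of G[S ─ N[ u ]]
-- with at most k + 1 - m vertices, while ∣ S ─ N[ u ] ∣ ≤ ∣ S ∣ - m.  Hence the count T(s, k)
-- satisfies T(s, k) ≤ m · T(s - m, k + 1 - m), and 2^(βs + γk) satisfies this recursion because
-- m · 2^γ ≤ 2^((β + γ) m) for all m ≥ 1: trivially for m ≤ 2, from γ ≥ 2 log₂ 3 - 3 for m = 3, and from
-- m² ≤ 2^m for m ≥ 4.  With γ = p / q and r = q - p, everything is raised to the power 2q.

module Submission where

open import Defs
open import Data.Nat using (ℕ; zero; suc; _+_; _*_; _∸_; _^_; _≤_; _<_; z≤n; s≤s; _≤?_)
open import Data.Nat.ListAction using (sum)
open import Data.Nat.Properties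
open import Algebra.Properties.CommutativeSemigroup *-commutativeSemigroup using (interchange; xy∙z≈xz∙y)
open import Data.Nat.Tactic.RingSolver using (solve-∀)
open import Data.Fin using (Fin; zero; suc) renaming (_≟_ to _≟ᶠ_)
open import Data.Fin.Properties using (any?)
open import Data.Fin.Subset
open import Data.Fin.Subset.Properties
open import Data.Fin.Subset.Induction using (Acc; acc; ⊂-wellFounded)
open import Data.List using (List; []; _∷_; length; map; filter)
open import Data.List.Extrema ≤-totalOrder using (argmin; argmax; argmin-all; argmax-all; f[argmin]≤f[xs]; f[xs]≤f[argmax])
open import Data.List.Membership.Propositional using (lose) renaming (_∈_ to _∈ₗ_)
open import Data.List.Membership.Propositional.Properties using (∈-map⁺)
open import Data.List.Properties using (filter-accept; length-map)
open import Data.List.Relation.Unary.All as All using (All; []; _∷_)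
open import Data.List.Relation.Unary.All.Properties as All using ()
open import Data.List.Relation.Unary.AllPairs using ([]; _∷_)
open import Data.List.Relation.Unary.Any as Any using (Any; here; there)
open import Data.List.Relation.Unary.Unique.Propositional using (Unique)
import Data.List.Relation.Unary.Unique.Propositional.Properties as Unique
open import Data.Product using (_×_; _,_; ∃-syntax; proj₁)
open import Data.Bool using (true)
open import Data.Sum using (_⊎_; inj₁; inj₂; swap)
open import Data.Vec using ([]; _∷_; tabulate; here; there)
open import Data.Vec.Properties using (lookup∘tabulate; []=⇒lookup; lookup⇒[]=)
open import Function using (_∘_; _$_)
open import Level using (0ℓ)
open import Relation.Binary.PropositionalEquality as ≡ using (_≡_; _≢_; refl; trans; cong; subst; module ≡-Reasoning)
open import Relation.Nullary using (Dec; yes; no; ¬_; ¬?; does; proof; contradiction)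
open import Relation.Nullary.Decidable using (_⊎-dec_; _×-dec_; dec-true; decidable-stable; ¬¬-excluded-middle)
open import Relation.Nullary.Reflects using (Reflects; invert)
open import Relation.Unary using (Pred; Decidable)

private variable
  A B I : Set
  n     : ℕ

^-distrib-* : ∀ a b e → (a * b) ^ e ≡ a ^ e * b ^ e
^-distrib-* a b zero    = refl
^-distrib-* a b (suc e) = begin
  a * b * (a * b) ^ e      ≡⟨ cong (a * b *_) (^-distrib-* a b e) ⟩
  a * b * (a ^ e * b ^ e)  ≡⟨ interchange a b (a ^ e) (b ^ e) ⟩
  a * a ^ e * (b * b ^ e)  ∎
  where open ≡-Reasoning

[4+j]²≤2^[4+j] : ∀ j → (4 + j) * (4 + j) ≤ 2 ^ (4 + j)
[4+j]²≤2^[4+j] zero    = ≤-refl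
[4+j]²≤2^[4+j] (suc j) = begin
  (5 + j) * (5 + j)                                     ≡⟨ square-step j ⟩
  (4 + j) * (4 + j) + (9 + 2 * j)                       ≤⟨ +-monoʳ-≤ ((4 + j) * (4 + j)) (m≤m+n _ _) ⟩
  (4 + j) * (4 + j) + (9 + 2 * j + (7 + 6 * j + j * j)) ≡⟨ cong ((4 + j) * (4 + j) +_) (square-split j) ⟩
  (4 + j) * (4 + j) + (4 + j) * (4 + j)                 ≤⟨ +-mono-≤ ih (≤-trans ih (m≤m+n _ 0)) ⟩
  2 ^ (5 + j)                                           ∎
  where
  open ≤-Reasoning
  ih = [4+j]²≤2^[4+j] j
  square-step : ∀ j → (5 + j) * (5 + j) ≡ (4 + j) * (4 + j) + (9 + 2 * j)
  square-step = solve-∀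
  square-split : ∀ j → 9 + 2 * j + (7 + 6 * j + j * j) ≡ (4 + j) * (4 + j)
  square-split = solve-∀

m≤1⇒m^n≤2^o : ∀ {m} n o → m ≤ 1 → m ^ n ≤ 2 ^ o
m≤1⇒m^n≤2^o n o m≤1 = ≤-trans (^-monoˡ-≤ n m≤1) (≤-trans (≤-reflexive (^-zeroˡ n)) (m^n>0 2 o))

module _ (r p : ℕ) where

  square-bound⇒branching : ∀ m E → (m * m) ^ (r + p) ≤ 2 ^ E → E + 2 * p ≤ r * m + 2 * p * m →
                           m ^ (2 * (r + p)) * 2 ^ (2 * p) ≤ 2 ^ (r * m + 2 * p * m)
  square-bound⇒branching m E m²-bound E-bound = begin
    m ^ (2 * (r + p)) * 2 ^ (2 * p)  ≡⟨ cong (_* 2 ^ (2 * p)) m^2q≡[m*m]^q ⟩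
    (m * m) ^ (r + p) * 2 ^ (2 * p)  ≤⟨ *-monoˡ-≤ (2 ^ (2 * p)) m²-bound ⟩
    2 ^ E * 2 ^ (2 * p)              ≡⟨ ^-distribˡ-+-* 2 E (2 * p) ⟨
    2 ^ (E + 2 * p)                  ≤⟨ ^-monoʳ-≤ 2 E-bound ⟩
    2 ^ (r * m + 2 * p * m)          ∎
    where
    open ≤-Reasoning
    m^2q≡[m*m]^q : m ^ (2 * (r + p)) ≡ (m * m) ^ (r + p)
    m^2q≡[m*m]^q = trans (≡.sym (^-*-assoc m 2 (r + p))) (cong (λ x → (m * x) ^ (r + p)) (*-identityʳ m))

  module _ (9^q≤2^[p+3q] : 9 ^ (r + p) ≤ 2 ^ (p + 3 * (r + p))) where

    -- m · 2^γ ≤ 2^((β + γ) m), raised to the power 2q.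
    branching-inequality : ∀ {m} → 1 ≤ m → m ^ (2 * (r + p)) * 2 ^ (2 * p) ≤ 2 ^ (r * m + 2 * p * m)
    branching-inequality {1} _ =
      square-bound⇒branching 1 0 (≤-reflexive (^-zeroˡ (r + p)))
        (≤-trans (m≤n+m (2 * p) r) (≤-reflexive (exponents r p)))
      where
      exponents : ∀ r p → r + 2 * p ≡ r * 1 + 2 * p * 1
      exponents = solve-∀
    branching-inequality {2} _ =
      square-bound⇒branching 2 (2 * (r + p)) (≤-reflexive (^-*-assoc 2 2 (r + p)))
        (≤-reflexive (exponents r p))
      where
      exponents : ∀ r p → 2 * (r + p) + 2 * p ≡ r * 2 + 2 * p * 2
      exponents = solve-∀
    branching-inequality {3} _ =
      square-bound⇒branching 3 (p + 3 * (r + p)) 9^q≤2^[p+3q] (≤-reflexive (exponents r p))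
      where
      exponents : ∀ r p → p + 3 * (r + p) + 2 * p ≡ r * 3 + 2 * p * 3
      exponents = solve-∀
    branching-inequality {suc (suc (suc (suc j)))} _ =
      square-bound⇒branching (4 + j) ((4 + j) * (r + p))
        (≤-trans (^-monoˡ-≤ (r + p) ([4+j]²≤2^[4+j] j)) (≤-reflexive (^-*-assoc 2 (4 + j) (r + p))))
        (≤-trans (m≤m+n _ (2 * p + j * p)) (≤-reflexive (exponents r p j)))
      where
      exponents : ∀ r p j → (4 + j) * (r + p) + 2 * p + (2 * p + j * p) ≡ r * (4 + j) + 2 * p * (4 + j)
      exponents = solve-∀

    branch-bound : ∀ {L B m s s′ k} → 1 ≤ m → s′ + m ≤ s → m ≤ suc k → L ≤ m * B →
                   B ^ (2 * (r + p)) ≤ 2 ^ (r * s′ + 2 * p * (suc k ∸ m)) →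
                   L ^ (2 * (r + p)) ≤ 2 ^ (r * s + 2 * p * k)
    branch-bound {L} {B} {m} {s} {s′} {k} 1≤m s′+m≤s m≤1+k L≤mB B-bound =
      *-cancelʳ-≤ _ _ (2 ^ (2 * p)) {{m^n≢0 2 (2 * p)}} (begin
        L ^ e * 2 ^ (2 * p)                                  ≤⟨ *-monoˡ-≤ (2 ^ (2 * p)) (^-monoˡ-≤ e L≤mB) ⟩
        (m * B) ^ e * 2 ^ (2 * p)                            ≡⟨ cong (_* 2 ^ (2 * p)) (^-distrib-* m B e) ⟩
        m ^ e * B ^ e * 2 ^ (2 * p)                          ≡⟨ xy∙z≈xz∙y (m ^ e) (B ^ e) (2 ^ (2 * p)) ⟩
        m ^ e * 2 ^ (2 * p) * B ^ e                          ≤⟨ *-mono-≤ (branching-inequality 1≤m) B-bound ⟩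
        2 ^ (r * m + 2 * p * m) * 2 ^ (r * s′ + 2 * p * k′)  ≡⟨ ^-distribˡ-+-* 2 (r * m + 2 * p * m) _ ⟨
        2 ^ (r * m + 2 * p * m + (r * s′ + 2 * p * k′))      ≤⟨ ^-monoʳ-≤ 2 exponent-bound ⟩
        2 ^ (r * s + 2 * p * k + 2 * p)                      ≡⟨ ^-distribˡ-+-* 2 (r * s + 2 * p * k) _ ⟩
        2 ^ (r * s + 2 * p * k) * 2 ^ (2 * p)                ∎)
      where
      open ≤-Reasoning
      e  = 2 * (r + p)
      k′ = suc k ∸ m
      regroup : ∀ r p m s′ k′ → r * m + 2 * p * m + (r * s′ + 2 * p * k′) ≡ r * (s′ + m) + 2 * p * (k′ + m)
      regroup = solve-∀
      unfold-suc : ∀ r p s k → r * s + 2 * p * suc k ≡ r * s + 2 * p * k + 2 * p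
      unfold-suc = solve-∀
      exponent-bound : r * m + 2 * p * m + (r * s′ + 2 * p * k′) ≤ r * s + 2 * p * k + 2 * p
      exponent-bound = begin
        r * m + 2 * p * m + (r * s′ + 2 * p * k′)  ≡⟨ regroup r p m s′ k′ ⟩
        r * (s′ + m) + 2 * p * (k′ + m)            ≤⟨ +-mono-≤ (*-monoʳ-≤ r s′+m≤s)
                                                                (≤-reflexive (cong (2 * p *_) (m∸n+n≡m m≤1+k))) ⟩
        r * s + 2 * p * suc k                      ≡⟨ unfold-suc r p s k ⟩
        r * s + 2 * p * k + 2 * p                  ∎

map⁺-injectiveOn : ∀ {P : Pred A 0ℓ} {f : A → B} {xs} → (∀ {x y} → P x → P y → f x ≡ f y → x ≡ y) →
                   All P xs → Unique xs → Unique (map f xs)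
map⁺-injectiveOn inj []         []            = []
map⁺-injectiveOn inj (px ∷ pxs) (x≢xs ∷ uniq) =
  All.map⁺ (All.zipWith (λ (py , x≢y) fx≡fy → x≢y (inj px py fx≡fy)) (pxs , x≢xs)) ∷ map⁺-injectiveOn inj pxs uniq

All-≡⇒length≤1 : ∀ {z : A} {xs} → All (_≡ z) xs → Unique xs → length xs ≤ 1
All-≡⇒length≤1 []              _               = z≤n
All-≡⇒length≤1 (_ ∷ [])        _               = ≤-refl
All-≡⇒length≤1 (x≡z ∷ y≡z ∷ _) ((x≢y ∷ _) ∷ _) = contradiction (trans x≡z (≡.sym y≡z)) x≢y

sum-map-mono-≤ : ∀ {f g : I → ℕ} → (∀ u → f u ≤ g u) → ∀ us → sum (map f us) ≤ sum (map g us)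
sum-map-mono-≤ f≤g []       = z≤n
sum-map-mono-≤ f≤g (u ∷ us) = +-mono-≤ (f≤g u) (sum-map-mono-≤ f≤g us)

sum-map-mono-< : ∀ {f g : I → ℕ} {us} → (∀ u → f u ≤ g u) → Any (λ u → f u < g u) us →
                 sum (map f us) < sum (map g us)
sum-map-mono-< {us = _ ∷ us} f≤g (here fu<gu) = +-mono-<-≤ fu<gu (sum-map-mono-≤ f≤g us)
sum-map-mono-< f≤g (there any)                = +-mono-≤-< (f≤g _) (sum-map-mono-< f≤g any)

sum-map≤length* : ∀ {f : I → ℕ} {b us} → All (λ u → f u ≤ b) us → sum (map f us) ≤ length us * b
sum-map≤length* []           = z≤n
sum-map≤length* (fu≤b ∷ f≤b) = +-mono-≤ fu≤b (sum-map≤length* f≤b)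

module _ {P : I → Pred A 0ℓ} (P? : ∀ u → Decidable (P u)) where

  length-filter-mono-∷ : ∀ u x xs → length (filter (P? u) xs) ≤ length (filter (P? u) (x ∷ xs))
  length-filter-mono-∷ u x xs with P? u x
  ... | yes _ = n≤1+n _
  ... | no  _ = ≤-refl

  length≤sum-length-filter : ∀ us xs → All (λ x → Any (λ u → P u x) us) xs →
                             length xs ≤ sum (map (λ u → length (filter (P? u) xs)) us)
  length≤sum-length-filter us []       []               = z≤n
  length≤sum-length-filter us (x ∷ xs) (covered ∷ rest) =
    ≤-trans (s≤s (length≤sum-length-filter us xs rest))
      (sum-map-mono-< (λ u → length-filter-mono-∷ u x xs)
        (Any.map (λ Pux → ≤-reflexive (≡.sym (cong length (filter-accept (P? _) Pux)))) covered))

∣p∣≡∣p∩q∣+∣p─q∣ : ∀ (p q : Subset n) → ∣ p ∣ ≡ ∣ p ∩ q ∣ + ∣ p ─ q ∣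
∣p∣≡∣p∩q∣+∣p─q∣ []            []            = refl
∣p∣≡∣p∩q∣+∣p─q∣ (inside  ∷ p) (inside  ∷ q) = cong suc (∣p∣≡∣p∩q∣+∣p─q∣ p q)
∣p∣≡∣p∩q∣+∣p─q∣ (inside  ∷ p) (outside ∷ q) = trans (cong suc (∣p∣≡∣p∩q∣+∣p─q∣ p q)) (≡.sym (+-suc _ _))
∣p∣≡∣p∩q∣+∣p─q∣ (outside ∷ p) (inside  ∷ q) = ∣p∣≡∣p∩q∣+∣p─q∣ p q
∣p∣≡∣p∩q∣+∣p─q∣ (outside ∷ p) (outside ∷ q) = ∣p∣≡∣p∩q∣+∣p─q∣ p q

∣p∣≤1+∣p-x∣ : ∀ (p : Subset n) x → ∣ p ∣ ≤ suc ∣ p - x ∣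
∣p∣≤1+∣p-x∣ p x = begin
  ∣ p ∣                      ≡⟨ ∣p∣≡∣p∩q∣+∣p─q∣ p ⁅ x ⁆ ⟩
  ∣ p ∩ ⁅ x ⁆ ∣ + ∣ p - x ∣  ≤⟨ +-monoˡ-≤ ∣ p - x ∣ (≤-trans (∣p∩q∣≤∣q∣ p ⁅ x ⁆) (≤-reflexive (∣⁅x⁆∣≡1 x))) ⟩
  suc ∣ p - x ∣              ∎
  where open ≤-Reasoning

x∈p⇒0<∣p∣ : ∀ {x} {p : Subset n} → x ∈ p → 0 < ∣ p ∣
x∈p⇒0<∣p∣ x∈p = ≤-trans (s≤s z≤n) (x∈p⇒∣p-x∣<∣p∣ x∈p)

x∈p─q⇒x∉q : ∀ {x} {p q : Subset n} → x ∈ p ─ q → x ∉ q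
x∈p─q⇒x∉q {p = _ ∷ _} {inside ∷ _} ()            here
x∈p─q⇒x∉q {p = _ ∷ _} {_      ∷ _} (there x∈p─q) (there x∈q) = x∈p─q⇒x∉q x∈p─q x∈q

elements : Subset n → List (Fin n)
elements []            = []
elements (inside  ∷ p) = zero ∷ map suc (elements p)
elements (outside ∷ p) = map suc (elements p)

length-elements : ∀ (p : Subset n) → length (elements p) ≡ ∣ p ∣
length-elements []            = refl
length-elements (inside  ∷ p) = cong suc (trans (length-map suc (elements p)) (length-elements p))
length-elements (outside ∷ p) = trans (length-map suc (elements p)) (length-elements p)

∈-elements⁺ : ∀ {x} {p : Subset n} → x ∈ p → x ∈ₗ elements p
∈-elements⁺ {p = inside  ∷ p} here        = here refl
∈-elements⁺ {p = inside  ∷ p} (there x∈p) = there (∈-map⁺ suc (∈-elements⁺ x∈p))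
∈-elements⁺ {p = outside ∷ p} (there x∈p) = ∈-map⁺ suc (∈-elements⁺ x∈p)

elements⊆ : ∀ (p : Subset n) → All (_∈ p) (elements p)
elements⊆ []            = []
elements⊆ (inside  ∷ p) = here ∷ All.map⁺ (All.map there (elements⊆ p))
elements⊆ (outside ∷ p) = All.map⁺ (All.map there (elements⊆ p))

module _ {P : Pred (Fin n) 0ℓ} (P? : Decidable P) where

  subsetOf : Subset n
  subsetOf = tabulate (does ∘ P?)

  ∈-subsetOf⁺ : ∀ {x} → P x → x ∈ subsetOf
  ∈-subsetOf⁺ {x} Px = lookup⇒[]= x subsetOf (trans (lookup∘tabulate (does ∘ P?) x) (dec-true (P? x) Px))

  ∈-subsetOf⁻ : ∀ {x} → x ∈ subsetOf → P x
  ∈-subsetOf⁻ {x} x∈ = invert (subst (Reflects (P x)) does≡true (proof (P? x)))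
    where
    does≡true : does (P? x) ≡ true
    does≡true = trans (≡.sym (lookup∘tabulate (does ∘ P?) x)) ([]=⇒lookup x∈)

module _ (f : Fin n → ℕ) {S : Subset n} {w : Fin n} (w∈S : w ∈ S) where

  ∃-minimiser : ∃[ v ] v ∈ S × ∀ {u} → u ∈ S → f v ≤ f u
  ∃-minimiser = argmin f w (elements S) , argmin-all f w∈S (elements⊆ S) ,
                λ u∈S → All.lookup (f[argmin]≤f[xs] w (elements S)) (∈-elements⁺ u∈S)

  ∃-maximiser : ∃[ v ] v ∈ S × ∀ {u} → u ∈ S → f u ≤ f v
  ∃-maximiser = argmax f w (elements S) , argmax-all f w∈S (elements⊆ S) ,
                λ u∈S → All.lookup (f[xs]≤f[argmax] w (elements S)) (∈-elements⁺ u∈S)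

module _ {P : Fin n → Pred A 0ℓ} (P? : ∀ u → Decidable (P u)) (H : Subset n) where

  union-bound : ∀ {b xs} → (∀ {u} → u ∈ H → length (filter (P? u) xs) ≤ b) →
                All (λ x → ∃[ u ] u ∈ H × P u x) xs → length xs ≤ ∣ H ∣ * b
  union-bound {b} {xs} ≤b covered = begin
    length xs                                                ≤⟨ length≤sum-length-filter P? (elements H) xs
                                                                  (All.map witness covered) ⟩
    sum (map (λ u → length (filter (P? u) xs)) (elements H)) ≤⟨ sum-map≤length* (All.map ≤b (elements⊆ H)) ⟩
    length (elements H) * b                                  ≡⟨ cong (_* b) (length-elements H) ⟩
    ∣ H ∣ * b                                                ∎
    where
    open ≤-Reasoning
    witness : ∀ {x} → ∃[ u ] u ∈ H × P u x → Any (λ u → P u x) (elements H)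
    witness (u , u∈H , Pux) = lose (∈-elements⁺ u∈H) Pux

avoiding : Fin n → List (Subset n) → List (Subset n)
avoiding u = filter (λ C → ¬? (u ∈? C))

module _ (G : Graph n) where

  -- A minimal vertex cover of the induced subgraph G[S], characterised locally: every vertex of C
  -- has a neighbour in S outside C.
  record MinimalCoverIn (S C : Subset n) : Set where
    field
      ⊆S           : C ⊆ S
      covers       : ∀ {i j} → Adj G i j → i ∈ S → j ∈ S → i ∈ C ⊎ j ∈ C
      private-edge : ∀ {w} → w ∈ C → ∃[ x ] x ∈ S × x ∉ C × Adj G w x
  open MinimalCoverIn

  module _ (adj? : ∀ i j → Dec (Adj G i j)) where

    ≡-or-adj? : ∀ u x → Dec (u ≡ x ⊎ Adj G u x)
    ≡-or-adj? u x = (u ≟ᶠ x) ⊎-dec adj? u x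

    N[_] : Fin n → Subset n
    N[ u ] = subsetOf (≡-or-adj? u)

    u∈N[u] : ∀ u → u ∈ N[ u ]
    u∈N[u] u = ∈-subsetOf⁺ (≡-or-adj? u) (inj₁ refl)

    adj⇒∈N[] : ∀ {u x} → Adj G u x → x ∈ N[ u ]
    adj⇒∈N[] adj = ∈-subsetOf⁺ (≡-or-adj? _) (inj₂ adj)

    ∈N[]⇒ : ∀ {u x} → x ∈ N[ u ] → u ≡ x ⊎ Adj G u x
    ∈N[]⇒ = ∈-subsetOf⁻ (≡-or-adj? _)

    avoids-N[] : ∀ {S C v} → MinimalCoverIn S C → v ∈ S → ∃[ u ] u ∈ S ∩ N[ v ] × u ∉ C
    avoids-N[] {C = C} {v} mc v∈S with v ∈? C
    ... | no  v∉C = v , x∈p∩q⁺ (v∈S , u∈N[u] v) , v∉C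
    ... | yes v∈C with private-edge mc v∈C
    ...   | x , x∈S , x∉C , adj = x , x∈p∩q⁺ (x∈S , adj⇒∈N[] adj) , x∉C

    module _ {S C u} (mc : MinimalCoverIn S C) (u∈S : u ∈ S) (u∉C : u ∉ C) where

      neighbour∈C : ∀ {x} → x ∈ S → Adj G u x → x ∈ C
      neighbour∈C x∈S adj with covers mc adj u∈S x∈S
      ... | inj₁ u∈C = contradiction u∈C u∉C
      ... | inj₂ x∈C = x∈C

      S∩N[u]-u⊆C∩N[u] : S ∩ N[ u ] - u ⊆ C ∩ N[ u ]
      S∩N[u]-u⊆C∩N[u] x∈ with x∈p∩q⁻ S N[ u ] (p─q⊆p _ _ x∈)
      ... | x∈S , x∈N[u] with ∈N[]⇒ x∈N[u]
      ...   | inj₁ u≡x = contradiction (≡.sym u≡x) (x∉⁅y⁆⇒x≢y (x∈p─q⇒x∉q x∈))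
      ...   | inj₂ adj = x∈p∩q⁺ (neighbour∈C x∈S adj , x∈N[u])

      ∣C─N[u]∣+∣S∩N[u]∣≤1+∣C∣ : ∣ C ─ N[ u ] ∣ + ∣ S ∩ N[ u ] ∣ ≤ suc ∣ C ∣
      ∣C─N[u]∣+∣S∩N[u]∣≤1+∣C∣ = begin
        ∣ C ─ N[ u ] ∣ + ∣ S ∩ N[ u ] ∣          ≤⟨ +-monoʳ-≤ ∣ C ─ N[ u ] ∣ (∣p∣≤1+∣p-x∣ (S ∩ N[ u ]) u) ⟩
        ∣ C ─ N[ u ] ∣ + suc ∣ S ∩ N[ u ] - u ∣  ≤⟨ +-monoʳ-≤ ∣ C ─ N[ u ] ∣ (s≤s (p⊆q⇒∣p∣≤∣q∣ S∩N[u]-u⊆C∩N[u])) ⟩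
        ∣ C ─ N[ u ] ∣ + suc ∣ C ∩ N[ u ] ∣      ≡⟨ +-suc ∣ C ─ N[ u ] ∣ _ ⟩
        suc (∣ C ─ N[ u ] ∣ + ∣ C ∩ N[ u ] ∣)    ≡⟨ cong suc (+-comm ∣ C ─ N[ u ] ∣ _) ⟩
        suc (∣ C ∩ N[ u ] ∣ + ∣ C ─ N[ u ] ∣)    ≡⟨ cong suc (∣p∣≡∣p∩q∣+∣p─q∣ C N[ u ]) ⟨
        suc ∣ C ∣                                ∎
        where open ≤-Reasoning

      cover-─N[] : MinimalCoverIn (S ─ N[ u ]) (C ─ N[ u ])
      cover-─N[] = record { ⊆S = ⊆S′ ; covers = covers′ ; private-edge = private-edge′ }
        where
        ⊆S′ : C ─ N[ u ] ⊆ S ─ N[ u ]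
        ⊆S′ x∈ = x∈p∧x∉q⇒x∈p─q (⊆S mc (p─q⊆p C N[ u ] x∈)) (x∈p─q⇒x∉q x∈)
        covers′ : ∀ {i j} → Adj G i j → i ∈ S ─ N[ u ] → j ∈ S ─ N[ u ] → i ∈ C ─ N[ u ] ⊎ j ∈ C ─ N[ u ]
        covers′ adj i∈ j∈ with covers mc adj (p─q⊆p S N[ u ] i∈) (p─q⊆p S N[ u ] j∈)
        ... | inj₁ i∈C = inj₁ (x∈p∧x∉q⇒x∈p─q i∈C (x∈p─q⇒x∉q i∈))
        ... | inj₂ j∈C = inj₂ (x∈p∧x∉q⇒x∈p─q j∈C (x∈p─q⇒x∉q j∈))
        private-edge′ : ∀ {w} → w ∈ C ─ N[ u ] → ∃[ x ] x ∈ S ─ N[ u ] × x ∉ C ─ N[ u ] × Adj G w x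
        private-edge′ {w} w∈ with private-edge mc (p─q⊆p C N[ u ] w∈)
        ... | x , x∈S , x∉C , adj = x , x∈p∧x∉q⇒x∈p─q x∈S x∉N[u] , x∉C ∘ p─q⊆p C N[ u ] , adj
          where
          x∉N[u] : x ∉ N[ u ]
          x∉N[u] x∈N[u] with ∈N[]⇒ x∈N[u]
          ... | inj₁ refl = x∈p─q⇒x∉q w∈ (adj⇒∈N[] (sym G adj))
          ... | inj₂ adj′ = x∉C (neighbour∈C x∈S adj′)

    ─N[]-reflects-⊆ : ∀ {S C₁ C₂ u} → MinimalCoverIn S C₁ → MinimalCoverIn S C₂ → u ∈ S → u ∉ C₁ → u ∉ C₂ →
                      C₁ ─ N[ u ] ⊆ C₂ ─ N[ u ] → C₁ ⊆ C₂
    ─N[]-reflects-⊆ {C₂ = C₂} {u} mc₁ mc₂ u∈S u∉C₁ u∉C₂ ⊆ {x} x∈C₁ with x ∈? N[ u ]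
    ... | no  x∉N[u] = p─q⊆p C₂ N[ u ] (⊆ (x∈p∧x∉q⇒x∈p─q x∈C₁ x∉N[u]))
    ... | yes x∈N[u] with ∈N[]⇒ x∈N[u]
    ...   | inj₁ refl = contradiction x∈C₁ u∉C₁
    ...   | inj₂ adj  = neighbour∈C mc₂ u∈S u∉C₂ (⊆S mc₁ x∈C₁) adj

    ─N[]-injective : ∀ {S C₁ C₂ u} → MinimalCoverIn S C₁ → MinimalCoverIn S C₂ → u ∈ S → u ∉ C₁ → u ∉ C₂ →
                     C₁ ─ N[ u ] ≡ C₂ ─ N[ u ] → C₁ ≡ C₂
    ─N[]-injective mc₁ mc₂ u∈S u∉C₁ u∉C₂ eq =
      ⊆-antisym (─N[]-reflects-⊆ mc₁ mc₂ u∈S u∉C₁ u∉C₂ (⊆-reflexive eq))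
                (─N[]-reflects-⊆ mc₂ mc₁ u∈S u∉C₂ u∉C₁ (⊆-reflexive (≡.sym eq)))

    minimal⇒MinimalCoverIn⊤ : ∀ {C} → IsMinimalVertexCover G C → MinimalCoverIn ⊤ C
    minimal⇒MinimalCoverIn⊤ {C} (vc , minimal) = record
      { ⊆S = λ _ → ∈⊤ ; covers = λ adj _ _ → vc _ _ adj ; private-edge = private-edge′ }
      where
      private-edge′ : ∀ {w} → w ∈ C → ∃[ x ] x ∈ ⊤ × x ∉ C × Adj G w x
      private-edge′ {w} w∈C with any? (λ x → ¬? (x ∈? C) ×-dec adj? w x)
      ... | yes (x , x∉C , adj) = x , ∈⊤ , x∉C , adj
      ... | no  no-private-edge = contradiction C-w-covers (minimal (C - w) (x∈p⇒p-x⊂p w∈C))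
        where
        endpoint∈C-w : ∀ {i j} → i ∈ C → Adj G i j → i ∈ C - w ⊎ j ∈ C - w
        endpoint∈C-w {i} {j} i∈C adj with i ≟ᶠ w
        ... | no  i≢w  = inj₁ (x∈p∧x≢y⇒x∈p-y i∈C i≢w)
        ... | yes refl = inj₂ (x∈p∧x≢y⇒x∈p-y j∈C j≢w)
          where
          j∈C : j ∈ C
          j∈C = decidable-stable (j ∈? C) (λ j∉C → no-private-edge (j , j∉C , adj))
          j≢w : j ≢ w
          j≢w refl = irrefl G adj
        C-w-covers : IsVertexCover G (C - w)
        C-w-covers i j adj with vc i j adj
        ... | inj₁ i∈C = endpoint∈C-w i∈C adj
        ... | inj₂ j∈C = swap (endpoint∈C-w j∈C (sym G adj))

    restrict-avoiding : ∀ {S k m u Cs} → u ∈ S → m ≤ ∣ S ∩ N[ u ] ∣ → Unique Cs →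
                        All (λ C → MinimalCoverIn S C × ∣ C ∣ ≤ k) Cs →
                        let Cs′ = map (_─ N[ u ]) (avoiding u Cs) in
                        Unique Cs′ × All (λ C → MinimalCoverIn (S ─ N[ u ]) C × ∣ C ∣ ≤ suc k ∸ m) Cs′
    restrict-avoiding {S} {k} {m} {u} {Cs} u∈S m≤∣S∩N[u]∣ uniq small =
      map⁺-injectiveOn (λ ((mc₁ , _) , u∉C₁) ((mc₂ , _) , u∉C₂) → ─N[]-injective mc₁ mc₂ u∈S u∉C₁ u∉C₂)
                       small-avoiding (Unique.filter⁺ _ uniq) ,
      All.map⁺ (All.map restrict small-avoiding)
      where
      small-avoiding : All (λ C → (MinimalCoverIn S C × ∣ C ∣ ≤ k) × u ∉ C) (avoiding u Cs)
      small-avoiding = All.zip (All.filter⁺ _ small , All.all-filter _ Cs)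
      restrict : ∀ {C} → (MinimalCoverIn S C × ∣ C ∣ ≤ k) × u ∉ C →
                 MinimalCoverIn (S ─ N[ u ]) (C ─ N[ u ]) × ∣ C ─ N[ u ] ∣ ≤ suc k ∸ m
      restrict {C} ((mc , ∣C∣≤k) , u∉C) = cover-─N[] mc u∈S u∉C , m+n≤o⇒m≤o∸n ∣ C ─ N[ u ] ∣ (begin
        ∣ C ─ N[ u ] ∣ + m                ≤⟨ +-monoʳ-≤ ∣ C ─ N[ u ] ∣ m≤∣S∩N[u]∣ ⟩
        ∣ C ─ N[ u ] ∣ + ∣ S ∩ N[ u ] ∣  ≤⟨ ∣C─N[u]∣+∣S∩N[u]∣≤1+∣C∣ mc u∈S u∉C ⟩
        suc ∣ C ∣                         ≤⟨ s≤s ∣C∣≤k ⟩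
        suc k                             ∎)
        where open ≤-Reasoning

    module _ (r p : ℕ) (9^q≤2^[p+3q] : 9 ^ (r + p) ≤ 2 ^ (p + 3 * (r + p))) where

      count-bound : ∀ S → Acc _⊂_ S → ∀ k {Cs} → Unique Cs → All (λ C → MinimalCoverIn S C × ∣ C ∣ ≤ k) Cs →
                    length Cs ^ (2 * (r + p)) ≤ 2 ^ (r * ∣ S ∣ + 2 * p * k)
      count-bound S _ k {[]} _ _ = m≤1⇒m^n≤2^o (2 * (r + p)) (r * ∣ S ∣ + 2 * p * k) z≤n
      count-bound S (acc rec) k {Cs@(C₀ ∷ _)} uniq small@((mc₀ , ∣C₀∣≤k) ∷ _) with nonempty? S
      ... | no S-empty = m≤1⇒m^n≤2^o (2 * (r + p)) (r * ∣ S ∣ + 2 * p * k) (All-≡⇒length≤1 all-empty uniq)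
        where
        all-empty : All (_≡ ⊥) Cs
        all-empty = All.map (λ (mc , _) → Empty-unique λ (x , x∈C) → S-empty (x , ⊆S mc x∈C)) small
      ... | yes (w , w∈S) with ∃-minimiser (λ v → ∣ S ∩ N[ v ] ∣) w∈S
      ...   | v , v∈S , v-min with ∃-maximiser (λ u → length (avoiding u Cs)) (x∈p∩q⁺ (v∈S , u∈N[u] v))
      ...     | u , u∈S∩N[v] , u-max =
        branch-bound r p 9^q≤2^[p+3q] (x∈p⇒0<∣p∣ (x∈p∩q⁺ (v∈S , u∈N[u] v))) ∣S─N[u]∣+m≤∣S∣ m≤1+k
                     length≤m*∣Cs′∣ IH
        where
        m   = ∣ S ∩ N[ v ] ∣
        u∈S = proj₁ (x∈p∩q⁻ S N[ v ] u∈S∩N[v])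
        Cs′ = map (_─ N[ u ]) (avoiding u Cs)
        m≤1+k : m ≤ suc k
        m≤1+k with avoids-N[] mc₀ v∈S
        ... | u₀ , u₀∈S∩N[v] , u₀∉C₀ = ≤-trans (v-min u₀∈S) (m+n≤o⇒n≤o _ (≤-trans
                (∣C─N[u]∣+∣S∩N[u]∣≤1+∣C∣ mc₀ u₀∈S u₀∉C₀) (s≤s ∣C₀∣≤k)))
          where u₀∈S = proj₁ (x∈p∩q⁻ S N[ v ] u₀∈S∩N[v])
        ∣S─N[u]∣+m≤∣S∣ : ∣ S ─ N[ u ] ∣ + m ≤ ∣ S ∣
        ∣S─N[u]∣+m≤∣S∣ = ≤-trans (+-monoʳ-≤ _ (v-min u∈S))
          (≤-reflexive (trans (+-comm ∣ S ─ N[ u ] ∣ ∣ S ∩ N[ u ] ∣) (≡.sym (∣p∣≡∣p∩q∣+∣p─q∣ S N[ u ]))))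
        length≤m*∣Cs′∣ : length Cs ≤ m * length Cs′
        length≤m*∣Cs′∣ = ≤-trans
          (union-bound (λ u C → ¬? (u ∈? C)) (S ∩ N[ v ]) u-max (All.map (λ (mc , _) → avoids-N[] mc v∈S) small))
          (≤-reflexive (cong (m *_) (≡.sym (length-map (_─ N[ u ]) (avoiding u Cs)))))
        IH : length Cs′ ^ (2 * (r + p)) ≤ 2 ^ (r * ∣ S ─ N[ u ] ∣ + 2 * p * (suc k ∸ m))
        IH = let (uniq′ , small′) = restrict-avoiding u∈S (v-min u∈S) uniq small in
             count-bound (S ─ N[ u ]) (rec (p∩q≢∅⇒p─q⊂p S N[ u ] (u , x∈p∩q⁺ (u∈S , u∈N[u] u))))
                         (suc k ∸ m) uniq′ small′

      minimal-vertex-cover-count : ∀ k {Cs} → Unique Cs → All (λ C → IsMinimalVertexCover G C × ∣ C ∣ ≤ k) Cs →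
                                   length Cs ^ (2 * (r + p)) ≤ 2 ^ (r * n + 2 * p * k)
      minimal-vertex-cover-count k {Cs} uniq mvcs =
        subst (λ s → length Cs ^ (2 * (r + p)) ≤ 2 ^ (r * s + 2 * p * k)) (∣⊤∣≡n n) $
        count-bound ⊤ (⊂-wellFounded ⊤) k uniq (All.map (λ (mvc , small) → minimal⇒MinimalCoverIn⊤ mvc , small) mvcs)

¬¬-∀-Fin : ∀ {P : Fin n → Set} → (∀ i → ¬ ¬ P i) → ¬ ¬ (∀ i → P i)
¬¬-∀-Fin {zero}  _   ¬∀P = ¬∀P (λ ())
¬¬-∀-Fin {suc n} ¬¬P ¬∀P = ¬¬P zero λ P₀ → ¬¬-∀-Fin (¬¬P ∘ suc) λ P₊ → ¬∀P λ { zero → P₀ ; (suc i) → P₊ i }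

¬¬-decidable : ∀ (R : Fin n → Fin n → Set) → ¬ ¬ (∀ i j → Dec (R i j))
¬¬-decidable R = ¬¬-∀-Fin λ i → ¬¬-∀-Fin λ j → ¬¬-excluded-middle

-- Adjacency need not be decidable, but the goal is a decidable inequality, so it may be proved under
-- the doubly negated assumption that adjacency is decidable.
theorem7 : (p q : ℕ) → 1 ≤ q → p ≤ q → 9 ^ q ≤ 2 ^ (p + 3 * q) →
           (n k : ℕ) → k ≤ n → (G : Graph n) → (Cs : List (Subset n)) → Unique Cs →
           All (λ C → IsMinimalVertexCover G C × ∣ C ∣ ≤ k) Cs →
           length Cs ^ (2 * q) ≤ 2 ^ ((q ∸ p) * n + 2 * p * k)
theorem7 p q _ p≤q 9^q≤2^[p+3q] n k _ G Cs uniq mvcs =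
  decidable-stable (_ ≤? _) λ ¬bound → ¬¬-decidable (Adj G) (¬bound ∘ bound)
  where
  r+p≡q : q ∸ p + p ≡ q
  r+p≡q = m∸n+n≡m p≤q
  bound : (∀ i j → Dec (Adj G i j)) → length Cs ^ (2 * q) ≤ 2 ^ ((q ∸ p) * n + 2 * p * k)
  bound adj? = subst (λ q′ → length Cs ^ (2 * q′) ≤ 2 ^ ((q ∸ p) * n + 2 * p * k)) r+p≡q $
    minimal-vertex-cover-count G adj? (q ∸ p) p
      (subst (λ q′ → 9 ^ q′ ≤ 2 ^ (p + 3 * q′)) (≡.sym r+p≡q) 9^q≤2^[p+3q]) k uniq mvcs
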